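{- Let $\mathcal{C}$ be a multipartite uniform clutter whose ground set is partitioned into nonempty parts $V_1,\dots,V_n$ such that every member meets each $V_i$ in exactly one element. Then $\mathcal{C}$ is ideal if and only if every localization of $\mathcal{C}$ (with respect to this partition) is ideal.
   Context: A clutter $\mathcal{C}$ over a finite ground set $V$ is a family of subsets of $V$, no member containing another. $\mathcal{C}$ is ideal if every extreme point of $\{x\in\mathbb{R}^V: x\geq\mathbf{0},\ \sum_{v\in C}x_v\geq 1\ \forall C\in\mathcal{C}\}$ is integral. For disjoint $I,J\subseteq V$, the minor $\mathcal{C}\setminus I/J$ is the clutter over $V-(I\cup J)$ of inclusion-minimal sets of $\{C-J: C\in\mathcal{C}, C\cap I=\emptyset\}$. A localization of $\mathcal{C}$ is any minor $\mathcal{C}/\{v_1,\dots,v_n\}$ obtained by contracting exactly one element $v_i$ from each part $V_i$ (and deleting nothing).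
   Formalization: In the definition of ideal, points of the polyhedron and its extreme points have rational coordinates and the convex weights are rational, rather than real. -}

module Defs where

open import Data.Bool using (Bool; true; false; if_then_else_)
open import Data.Nat using (ℕ; zero; suc)
open import Data.Integer using (ℤ)
open import Data.Fin using (Fin; zero; suc)
open import Data.Fin.Subset as S using (Subset; ∁; _─_; _⊆_; _⊂_)
open import Data.Vec using (Vec; []; _∷_)
open import Data.List using (List)
import Data.List.Membership.Propositional as L
open import Data.Rational using (ℚ; 0ℚ; 1ℚ; _+_; _*_; _-_; _≤_; _<_; _/_)
open import Data.Product using (Σ; ∃; _×_; _,_)
open import Relation.Binary.PropositionalEquality using (_≡_)
open import Relation.Nullary using (¬_)

sumOn : ∀ {m} → Subset m → (Fin m → ℚ) → ℚ
sumOn [] x = 0ℚ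
sumOn (b ∷ s) x = (if b then x zero else 0ℚ) + sumOn s (λ i → x (suc i))

Family : ℕ → Set₁
Family m = Subset m → Set

members : ∀ {m} → List (Subset m) → Family m
members 𝒞 C = C L.∈ 𝒞

IsClutter : ∀ {m} → List (Subset m) → Set
IsClutter 𝒞 = ∀ {C D} → C L.∈ 𝒞 → D L.∈ 𝒞 → C ⊆ D → C ≡ D

-- the points x ∈ ℚ^U (coordinates outside the ground set U are 0) of
-- the polyhedron {x ≥ 0, x(C) ≥ 1 for all members C}
InPolyhedron : ∀ {m} → Subset m → Family m → (Fin m → ℚ) → Set
InPolyhedron U 𝒞 x =
  (∀ v → v S.∉ U → x v ≡ 0ℚ) ×
  (∀ v → v S.∈ U → 0ℚ ≤ x v) ×
  (∀ C → 𝒞 C → 1ℚ ≤ sumOn C x)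

IsExtremePoint : ∀ {m} → Subset m → Family m → (Fin m → ℚ) → Set
IsExtremePoint {m} U 𝒞 x =
  InPolyhedron U 𝒞 x ×
  (∀ (λ' : ℚ) (y z : Fin m → ℚ) → 0ℚ < λ' → λ' < 1ℚ →
     InPolyhedron U 𝒞 y → InPolyhedron U 𝒞 z →
     (∀ v → x v ≡ λ' * y v + (1ℚ - λ') * z v) → y ≡ z)

IsIntegral : ∀ {m} → (Fin m → ℚ) → Set
IsIntegral x = ∀ v → ∃ λ (k : ℤ) → x v ≡ k / 1

Ideal : ∀ {m} → Subset m → Family m → Set
Ideal U 𝒞 = ∀ x → IsExtremePoint U 𝒞 x → IsIntegral x

-- contraction 𝒞 / J : inclusion-minimal sets among {C − J : C ∈ 𝒞}
-- (its ground set is ∁ J)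
Contract : ∀ {m} → Family m → Subset m → Family m
Contract 𝒞 J D =
  (∃ λ C → 𝒞 C × D ≡ C ─ J) ×
  (∀ E → (∃ λ C → 𝒞 C × E ≡ C ─ J) → ¬ (E ⊂ D))

MultipartiteUniform : ∀ {m n} → (Fin m → Fin n) → List (Subset m) → Set
MultipartiteUniform {m} part 𝒞 =
  ∀ {C} → C L.∈ 𝒞 → ∀ i →
    Σ (Fin m) λ v → (v S.∈ C) × (part v ≡ i) ×
      (∀ w → w S.∈ C → part w ≡ i → w ≡ v)

-- the set {c 1, …, c n} of contracted elements, for a transversal c
-- (c i ∈ V_i); v is in it iff v = c (part v)
Transversal : ∀ {m n} → (Fin m → Fin n) → (Fin n → Fin m) → Subset m → Set
Transversal part c J = ∀ v → (v S.∈ J → c (part v) ≡ v) × (c (part v) ≡ v → v S.∈ J)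

{-# OPTIONS --safe #-}
module Submission where

-- Contracting J corresponds to the face {x ∈ P(𝒞) : x vanishes on J} of P(𝒞): the points of
-- P(𝒞 / J) are exactly the points of P(𝒞) vanishing on J.  Hence extreme points of P(𝒞 / J) are
-- extreme points of P(𝒞), and contractions of ideal clutters are ideal.  Conversely, let x be an
-- extreme point of P(𝒞).  If x has a zero coordinate c i in every part V_i, then x is an extreme
-- point of P(𝒞 / {c 1, …, c n}), hence integral by idealness of that localization.  Otherwise x is
-- positive on some part V_i; since every member meets V_i exactly once, x ± δ (x - 1_{V_i}) lie in
-- P(𝒞) for small δ > 0, and extremality forces x = 1_{V_i}.

open import Defs
open import Data.Bool using (true; false; if_then_else_)
open import Data.Empty using (⊥-elim)
open import Data.Fin using (Fin; zero; suc; _≟_)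
open import Data.Fin.Properties using (all?; any?; ¬∀⟶∃¬; suc-injective)
open import Data.Fin.Subset using (Subset; ⊤; ∁; _─_; _⊆_; _⊂_; _∈_; ∣_∣)
open import Data.Fin.Subset.Properties
  using (∈⊤; _∈?_; x∈p⇒x∉∁p; x∉∁p⇒x∈p; drop-∷-⊆; ⊆-refl; ⊆-trans; _⊂?_; p⊂q⇒∣p∣<∣q∣)
import Data.Integer as ℤ
open import Data.List using (List)
open import Data.List.Membership.Propositional using (find; lose) renaming (_∈_ to _∈ₗ_)
import Data.List.Relation.Unary.Any as Any
open import Data.Nat using (ℕ; zero; suc)
open import Data.Nat.Induction using (<-wellFounded)
open import Data.Product using (∃; _×_; _,_; proj₁; proj₂)
open import Data.Rational
  using (ℚ; 0ℚ; 1ℚ; ½; _+_; _*_; _-_; -_; _≤_; _<_; _/_; 1/_; _⊓_; NonZero; positive; nonNegative)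
import Data.Rational.Properties as ℚ
open import Algebra.Properties.Group ℚ.+-0-group using (x∙y⁻¹≈ε⇒x≈y)
open import Data.Rational.Solver using (module +-*-Solver)
open import Data.Sum using (_⊎_; inj₁; inj₂; [_,_]′)
open import Data.Vec using ([]; _∷_; here; there; tabulate)
open import Data.Vec.Properties using (lookup∘tabulate; []=⇒lookup; lookup⇒[]=)
open import Function using (_∘_)
open import Induction.WellFounded using (WellFounded; Acc; acc; module Subrelation)
open import Level using (0ℓ)
import Relation.Binary.Construct.On as On
open import Relation.Binary.PropositionalEquality
  using (_≡_; _≢_; _≗_; refl; sym; trans; cong; cong₂; cong-app; subst; module ≡-Reasoning)
open import Relation.Nullary using (Dec; does; yes; no; ¬_; contradiction)
open import Relation.Nullary.Decidable using (toWitness; _×-dec_)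
open import Relation.Unary using (Pred; Decidable)

open +-*-Solver

0<1 : 0ℚ < 1ℚ
0<1 = toWitness {a? = 0ℚ ℚ.<? 1ℚ} _

0<½ : 0ℚ < ½
0<½ = toWitness {a? = 0ℚ ℚ.<? ½} _

½<1 : ½ < 1ℚ
½<1 = toWitness {a? = ½ ℚ.<? 1ℚ} _

0≤p+q : ∀ {p q} → 0ℚ ≤ p → 0ℚ ≤ q → 0ℚ ≤ p + q
0≤p+q = ℚ.+-mono-≤

0≤p*q : ∀ {p q} → 0ℚ ≤ p → 0ℚ ≤ q → 0ℚ ≤ p * q
0≤p*q {p} {q} 0≤p 0≤q =
  ℚ.nonNegative⁻¹ (p * q) {{ℚ.nonNeg*nonNeg⇒nonNeg p {{nonNegative 0≤p}} q {{nonNegative 0≤q}}}}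

p≤q⇒0≤q-p : ∀ {p q} → p ≤ q → 0ℚ ≤ q - p
p≤q⇒0≤q-p {p} {q} p≤q = subst (_≤ q - p) (ℚ.+-inverseʳ p) (ℚ.+-monoˡ-≤ (- p) p≤q)

p<q⇒0<q-p : ∀ {p q} → p < q → 0ℚ < q - p
p<q⇒0<q-p {p} {q} p<q = subst (_< q - p) (ℚ.+-inverseʳ p) (ℚ.+-monoˡ-< (- p) p<q)

0≤p∧p≢0⇒0<p : ∀ {p} → 0ℚ ≤ p → p ≢ 0ℚ → 0ℚ < p
0≤p∧p≢0⇒0<p {p} 0≤p p≢0 with p ℚ.≤? 0ℚ
... | yes p≤0 = ⊥-elim (p≢0 (ℚ.≤-antisym p≤0 0≤p))
... | no p≰0 = ℚ.≰⇒> p≰0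

p≤p+q : ∀ p {q} → 0ℚ ≤ q → p ≤ p + q
p≤p+q p 0≤q = subst (_≤ p + _) (ℚ.+-identityʳ p) (ℚ.+-monoʳ-≤ p 0≤q)

p+q≡0⇒p≡0 : ∀ {p q} → 0ℚ ≤ p → 0ℚ ≤ q → p + q ≡ 0ℚ → p ≡ 0ℚ
p+q≡0⇒p≡0 {p} 0≤p 0≤q p+q≡0 = ℚ.≤-antisym (subst (p ≤_) p+q≡0 (p≤p+q p 0≤q)) 0≤p

pos*q≡0⇒q≡0 : ∀ {p q} → 0ℚ < p → p * q ≡ 0ℚ → q ≡ 0ℚ
pos*q≡0⇒q≡0 {p} {q} 0<p p*q≡0 = begin
  q              ≡⟨ sym (ℚ.*-identityˡ q) ⟩
  1ℚ * q         ≡⟨ cong (_* q) (sym (ℚ.*-inverseˡ p)) ⟩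
  (1/ p * p) * q ≡⟨ ℚ.*-assoc (1/ p) p q ⟩
  1/ p * (p * q) ≡⟨ cong (1/ p *_) p*q≡0 ⟩
  1/ p * 0ℚ      ≡⟨ ℚ.*-zeroʳ (1/ p) ⟩
  0ℚ             ∎
  where
  open ≡-Reasoning
  instance
    p≢0 : NonZero p
    p≢0 = ℚ.pos⇒nonZero p {{positive 0<p}}

convex-combination≡0 : ∀ {t p q} → 0ℚ < t → t < 1ℚ → 0ℚ ≤ p → 0ℚ ≤ q →
                       t * p + (1ℚ - t) * q ≡ 0ℚ → p ≡ 0ℚ × q ≡ 0ℚ
convex-combination≡0 {t} {p} {q} 0<t t<1 0≤p 0≤q sum≡0 =
  pos*q≡0⇒q≡0 0<t (p+q≡0⇒p≡0 0≤tp 0≤[1-t]q sum≡0) ,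
  pos*q≡0⇒q≡0 0<1-t (p+q≡0⇒p≡0 0≤[1-t]q 0≤tp (trans (ℚ.+-comm ((1ℚ - t) * q) (t * p)) sum≡0))
  where
  0<1-t : 0ℚ < 1ℚ - t
  0<1-t = p<q⇒0<q-p t<1
  0≤tp : 0ℚ ≤ t * p
  0≤tp = 0≤p*q (ℚ.<⇒≤ 0<t) 0≤p
  0≤[1-t]q : 0ℚ ≤ (1ℚ - t) * q
  0≤[1-t]q = 0≤p*q (ℚ.<⇒≤ 0<1-t) 0≤q

1≤p⇒1≤p+k*[p-1] : ∀ {p k} → 1ℚ ≤ p → 0ℚ ≤ 1ℚ + k → 1ℚ ≤ p + k * (p - 1ℚ)
1≤p⇒1≤p+k*[p-1] {p} {k} 1≤p 0≤1+k =
  subst (1ℚ ≤_)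
        (solve 2 (λ p k → con 1ℚ :+ (con 1ℚ :+ k) :* (p :- con 1ℚ) := p :+ k :* (p :- con 1ℚ)) refl p k)
        (p≤p+q 1ℚ (0≤p*q 0≤1+k (p≤q⇒0≤q-p 1≤p)))

p±δ[p-e]-nonNeg : ∀ {p e δ} → 0ℚ ≤ p → 0ℚ ≤ δ → δ ≤ 1ℚ → e ≡ 0ℚ ⊎ (e ≡ 1ℚ × δ ≤ p) →
                  0ℚ ≤ p + δ * (p - e) × 0ℚ ≤ p + (- δ) * (p - e)
p±δ[p-e]-nonNeg {p} {δ = δ} 0≤p 0≤δ δ≤1 (inj₁ refl) =
  subst (0ℚ ≤_) (solve 2 (λ p δ → p :+ δ :* p := p :+ δ :* (p :- con 0ℚ)) refl p δ)
        (0≤p+q 0≤p (0≤p*q 0≤δ 0≤p)) ,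
  subst (0ℚ ≤_) (solve 2 (λ p δ → (con 1ℚ :- δ) :* p := p :+ (:- δ) :* (p :- con 0ℚ)) refl p δ)
        (0≤p*q (p≤q⇒0≤q-p δ≤1) 0≤p)
p±δ[p-e]-nonNeg {p} {δ = δ} 0≤p 0≤δ δ≤1 (inj₂ (refl , δ≤p)) =
  subst (0ℚ ≤_) (solve 2 (λ p δ → (p :- δ) :+ δ :* p := p :+ δ :* (p :- con 1ℚ)) refl p δ)
        (0≤p+q (p≤q⇒0≤q-p δ≤p) (0≤p*q 0≤δ 0≤p)) ,
  subst (0ℚ ≤_) (solve 2 (λ p δ → (con 1ℚ :- δ) :* p :+ δ := p :+ (:- δ) :* (p :- con 1ℚ)) refl p δ)
        (0≤p+q (0≤p*q (p≤q⇒0≤q-p δ≤1) 0≤p) 0≤δ)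

positive-lower-bound : ∀ {m} {P : Pred (Fin m) 0ℓ} → Decidable P → (f : Fin m → ℚ) →
                       (∀ v → P v → 0ℚ < f v) → ∃ λ δ → 0ℚ < δ × δ ≤ 1ℚ × (∀ v → P v → δ ≤ f v)
positive-lower-bound {zero} P? f 0<f = 1ℚ , 0<1 , ℚ.≤-refl , λ ()
positive-lower-bound {suc m} P? f 0<f
  with δ , 0<δ , δ≤1 , δ≤f ← positive-lower-bound (P? ∘ suc) (f ∘ suc) (0<f ∘ suc) | P? zero
... | no ¬P₀ = δ , 0<δ , δ≤1 , λ { zero P₀ → ⊥-elim (¬P₀ P₀) ; (suc v) → δ≤f v }
... | yes P₀ = f zero ⊓ δ , 0<f₀⊓δ , ℚ.p≤q⇒r⊓p≤q (f zero) δ≤1 ,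
               λ { zero _ → ℚ.p⊓q≤p (f zero) δ ; (suc v) Pv → ℚ.p≤q⇒r⊓p≤q (f zero) (δ≤f v Pv) }
  where
  0<f₀⊓δ : 0ℚ < f zero ⊓ δ
  0<f₀⊓δ = [ (λ ≡f₀ → subst (0ℚ <_) (sym ≡f₀) (0<f zero P₀)) , (λ ≡δ → subst (0ℚ <_) (sym ≡δ) 0<δ) ]′
             (ℚ.⊓-sel (f zero) δ)

sumOn-cong : ∀ {m} (C : Subset m) {f g : Fin m → ℚ} → f ≗ g → sumOn C f ≡ sumOn C g
sumOn-cong [] f≗g = refl
sumOn-cong (b ∷ C) f≗g =
  cong₂ _+_ (cong (λ q → if b then q else 0ℚ) (f≗g zero)) (sumOn-cong C (f≗g ∘ suc))

sumOn-linear : ∀ {m} (C : Subset m) (a b : ℚ) (f g : Fin m → ℚ) →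
               sumOn C (λ v → a * f v + b * g v) ≡ a * sumOn C f + b * sumOn C g
sumOn-linear [] a b f g = solve 2 (λ a b → con 0ℚ := a :* con 0ℚ :+ b :* con 0ℚ) refl a b
sumOn-linear (true ∷ C) a b f g =
  trans (cong (a * f zero + b * g zero +_) (sumOn-linear C a b (f ∘ suc) (g ∘ suc)))
        (solve 6 (λ a b f₀ g₀ F G → (a :* f₀ :+ b :* g₀) :+ (a :* F :+ b :* G)
                                    := a :* (f₀ :+ F) :+ b :* (g₀ :+ G))
               refl a b (f zero) (g zero) (sumOn C (f ∘ suc)) (sumOn C (g ∘ suc)))
sumOn-linear (false ∷ C) a b f g =
  trans (cong (0ℚ +_) (sumOn-linear C a b (f ∘ suc) (g ∘ suc)))
        (solve 4 (λ a b F G → con 0ℚ :+ (a :* F :+ b :* G)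
                              := a :* (con 0ℚ :+ F) :+ b :* (con 0ℚ :+ G))
               refl a b (sumOn C (f ∘ suc)) (sumOn C (g ∘ suc)))

sumOn-─ : ∀ {m} (C J : Subset m) (f : Fin m → ℚ) → (∀ v → v ∈ J → f v ≡ 0ℚ) →
          sumOn (C ─ J) f ≡ sumOn C f
sumOn-─ [] [] f f≡0 = refl
sumOn-─ (b ∷ C) (true ∷ J) f f≡0 =
  cong₂ _+_ (f₀≡0 b) (sumOn-─ C J (f ∘ suc) (λ v → f≡0 (suc v) ∘ there))
  where
  f₀≡0 : ∀ b → 0ℚ ≡ (if b then f zero else 0ℚ)
  f₀≡0 true = sym (f≡0 zero here)
  f₀≡0 false = refl
sumOn-─ (b ∷ C) (false ∷ J) f f≡0 =
  cong ((if b then f zero else 0ℚ) +_) (sumOn-─ C J (f ∘ suc) (λ v → f≡0 (suc v) ∘ there))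

sumOn-mono-⊆ : ∀ {m} (D C : Subset m) (f : Fin m → ℚ) → (∀ v → 0ℚ ≤ f v) → D ⊆ C →
               sumOn D f ≤ sumOn C f
sumOn-mono-⊆ [] [] f 0≤f D⊆C = ℚ.≤-refl
sumOn-mono-⊆ (true ∷ D) (true ∷ C) f 0≤f D⊆C =
  ℚ.+-monoʳ-≤ (f zero) (sumOn-mono-⊆ D C (f ∘ suc) (0≤f ∘ suc) (drop-∷-⊆ D⊆C))
sumOn-mono-⊆ (true ∷ D) (false ∷ C) f 0≤f D⊆C with () ← D⊆C here
sumOn-mono-⊆ (false ∷ D) (true ∷ C) f 0≤f D⊆C =
  ℚ.+-mono-≤ (0≤f zero) (sumOn-mono-⊆ D C (f ∘ suc) (0≤f ∘ suc) (drop-∷-⊆ D⊆C))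
sumOn-mono-⊆ (false ∷ D) (false ∷ C) f 0≤f D⊆C =
  ℚ.+-monoʳ-≤ 0ℚ (sumOn-mono-⊆ D C (f ∘ suc) (0≤f ∘ suc) (drop-∷-⊆ D⊆C))

sumOn-zero : ∀ {m} (C : Subset m) (f : Fin m → ℚ) → (∀ v → v ∈ C → f v ≡ 0ℚ) → sumOn C f ≡ 0ℚ
sumOn-zero [] f f≡0 = refl
sumOn-zero (true ∷ C) f f≡0 =
  cong₂ _+_ (f≡0 zero here) (sumOn-zero C (f ∘ suc) (λ v → f≡0 (suc v) ∘ there))
sumOn-zero (false ∷ C) f f≡0 =
  cong (0ℚ +_) (sumOn-zero C (f ∘ suc) (λ v → f≡0 (suc v) ∘ there))

sumOn-unique : ∀ {m} (C : Subset m) (f : Fin m → ℚ) {v} → v ∈ C →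
               (∀ w → w ∈ C → w ≢ v → f w ≡ 0ℚ) → sumOn C f ≡ f v
sumOn-unique (true ∷ C) f here f≡0 =
  trans (cong (f zero +_) (sumOn-zero C (f ∘ suc) (λ w w∈C → f≡0 (suc w) (there w∈C) λ ())))
        (ℚ.+-identityʳ (f zero))
sumOn-unique (b ∷ C) f {suc v} (there v∈C) f≡0 =
  trans (cong₂ _+_ (f₀≡0 b f≡0)
                   (sumOn-unique C (f ∘ suc) v∈C
                      (λ w w∈C w≢v → f≡0 (suc w) (there w∈C) (w≢v ∘ suc-injective))))
        (ℚ.+-identityˡ (f (suc v)))
  where
  f₀≡0 : ∀ b → (∀ w → w ∈ b ∷ C → w ≢ suc v → f w ≡ 0ℚ) → (if b then f zero else 0ℚ) ≡ 0ℚ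
  f₀≡0 true f≡0 = f≡0 zero here λ ()
  f₀≡0 false _ = refl

inPolyhedron-nonNeg : ∀ {m} {U : Subset m} {𝒟 : Family m} {x : Fin m → ℚ} →
                      InPolyhedron U 𝒟 x → ∀ v → 0ℚ ≤ x v
inPolyhedron-nonNeg {U = U} (outside≡0 , inside≥0 , _) v with v ∈? U
... | yes v∈U = inside≥0 v v∈U
... | no v∉U = ℚ.≤-reflexive (sym (outside≡0 v v∉U))

-- x is the midpoint of x + k g and x - k g.
extreme-direction≡0 : ∀ {m} {U : Subset m} {𝒟 : Family m} {x : Fin m → ℚ} → IsExtremePoint U 𝒟 x →
                      ∀ k (g : Fin m → ℚ) → 0ℚ < k → InPolyhedron U 𝒟 (λ v → x v + k * g v) →
                      InPolyhedron U 𝒟 (λ v → x v + (- k) * g v) → ∀ v → g v ≡ 0ℚ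
extreme-direction≡0 {x = x} (_ , extreme) k g 0<k x+kg∈P x-kg∈P v =
  pos*q≡0⇒q≡0 (ℚ.+-mono-< 0<k 0<k) (begin
    (k + k) * g v
      ≡⟨ solve 3 (λ x k g → (k :+ k) :* g := (x :+ k :* g) :- (x :+ (:- k) :* g)) refl (x v) k (g v) ⟩
    (x v + k * g v) - (x v + (- k) * g v)
      ≡⟨ cong (λ q → (x v + k * g v) - q) (sym (cong-app x+kg≡x-kg v)) ⟩
    (x v + k * g v) - (x v + k * g v)
      ≡⟨ ℚ.+-inverseʳ (x v + k * g v) ⟩
    0ℚ
      ∎)
  where
  open ≡-Reasoning
  x+kg≡x-kg : (λ v → x v + k * g v) ≡ (λ v → x v + (- k) * g v)
  x+kg≡x-kg = extreme ½ (λ v → x v + k * g v) (λ v → x v + (- k) * g v) 0<½ ½<1 x+kg∈P x-kg∈P λ v →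
    solve 3 (λ x k g → x := con ½ :* (x :+ k :* g) :+ (con 1ℚ :- con ½) :* (x :+ (:- k) :* g))
          refl (x v) k (g v)

perturbation-inPolyhedron : ∀ {m} {𝒟 : Family m} {x e : Fin m → ℚ} → (∀ C → 𝒟 C → sumOn C e ≡ 1ℚ) →
                            InPolyhedron ⊤ 𝒟 x → ∀ k → 0ℚ ≤ 1ℚ + k →
                            (∀ v → 0ℚ ≤ x v + k * (x v - e v)) →
                            InPolyhedron ⊤ 𝒟 (λ v → x v + k * (x v - e v))
perturbation-inPolyhedron {𝒟 = 𝒟} {x} {e} e-sums-to-1 (_ , _ , covers) k 0≤1+k 0≤x+k[x-e] =
  (λ v v∉⊤ → ⊥-elim (v∉⊤ ∈⊤)) , (λ v _ → 0≤x+k[x-e] v) , λ C C∈𝒟 →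
    subst (1ℚ ≤_) (sym (sum C C∈𝒟)) (1≤p⇒1≤p+k*[p-1] {k = k} (covers C C∈𝒟) 0≤1+k)
  where
  open ≡-Reasoning
  sum : ∀ C → 𝒟 C → sumOn C (λ v → x v + k * (x v - e v)) ≡ sumOn C x + k * (sumOn C x - 1ℚ)
  sum C C∈𝒟 = begin
    sumOn C (λ v → x v + k * (x v - e v))
      ≡⟨ sumOn-cong C (λ v → solve 3 (λ x k e → x :+ k :* (x :- e) := (con 1ℚ :+ k) :* x :+ (:- k) :* e)
                                     refl (x v) k (e v)) ⟩
    sumOn C (λ v → (1ℚ + k) * x v + (- k) * e v)
      ≡⟨ sumOn-linear C (1ℚ + k) (- k) x e ⟩
    (1ℚ + k) * sumOn C x + (- k) * sumOn C e
      ≡⟨ cong (λ q → (1ℚ + k) * sumOn C x + (- k) * q) (e-sums-to-1 C C∈𝒟) ⟩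
    (1ℚ + k) * sumOn C x + (- k) * 1ℚ
      ≡⟨ solve 2 (λ s k → (con 1ℚ :+ k) :* s :+ (:- k) :* con 1ℚ := s :+ k :* (s :- con 1ℚ))
               refl (sumOn C x) k ⟩
    sumOn C x + k * (sumOn C x - 1ℚ)
      ∎

⊂-wellFounded : ∀ {m} → WellFounded (_⊂_ {m})
⊂-wellFounded = Subrelation.wellFounded p⊂q⇒∣p∣<∣q∣ (On.wellFounded ∣_∣ <-wellFounded)

inPolyhedron-contract⁺ : ∀ {m} {𝒟 : Family m} {J : Subset m} {y : Fin m → ℚ} → InPolyhedron ⊤ 𝒟 y →
                         (∀ v → v ∈ J → y v ≡ 0ℚ) → InPolyhedron (∁ J) (Contract 𝒟 J) y
inPolyhedron-contract⁺ {𝒟 = 𝒟} {J} {y} (_ , 0≤y , covers) y≡0-on-J =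
  (λ v v∉∁J → y≡0-on-J v (x∉∁p⇒x∈p v∉∁J)) , (λ v _ → 0≤y v ∈⊤) , covers/J
  where
  covers/J : ∀ D → Contract 𝒟 J D → 1ℚ ≤ sumOn D y
  covers/J D ((C , C∈𝒟 , refl) , _) = subst (1ℚ ≤_) (sym (sumOn-─ C J y y≡0-on-J)) (covers C C∈𝒟)

module _ {m} (𝒞 : List (Subset m)) (J : Subset m) where

  contract-member-⊆ : ∀ {E} → Acc _⊂_ E → (∃ λ C → C ∈ₗ 𝒞 × E ≡ C ─ J) →
                      ∃ λ D → Contract (members 𝒞) J D × D ⊆ E
  contract-member-⊆ {E} (acc smaller) E∈𝒞─J with Any.any? (λ C → (C ─ J) ⊂? E) 𝒞
  ... | no none = E , (E∈𝒞─J , λ { F (C , C∈𝒞 , refl) F⊂E → none (lose C∈𝒞 F⊂E) }) , ⊆-refl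
  ... | yes some with C , C∈𝒞 , C─J⊂E ← find some
                  with D , D∈𝒞/J , D⊆C─J ← contract-member-⊆ (smaller C─J⊂E) (C , C∈𝒞 , refl)
                  = D , D∈𝒞/J , ⊆-trans D⊆C─J (proj₁ C─J⊂E)

  inPolyhedron-contract⁻ : ∀ {y} → InPolyhedron (∁ J) (Contract (members 𝒞) J) y →
                           InPolyhedron ⊤ (members 𝒞) y × (∀ v → v ∈ J → y v ≡ 0ℚ)
  inPolyhedron-contract⁻ {y} y∈P/J@(outside≡0 , _ , covers/J) =
    ((λ v v∉⊤ → ⊥-elim (v∉⊤ ∈⊤)) , (λ v _ → 0≤y v) , covers) , y≡0-on-J
    where
    0≤y : ∀ v → 0ℚ ≤ y v
    0≤y = inPolyhedron-nonNeg y∈P/J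
    y≡0-on-J : ∀ v → v ∈ J → y v ≡ 0ℚ
    y≡0-on-J v v∈J = outside≡0 v (x∈p⇒x∉∁p v∈J)
    covers : ∀ C → C ∈ₗ 𝒞 → 1ℚ ≤ sumOn C y
    covers C C∈𝒞 with D , D∈𝒞/J , D⊆C─J ← contract-member-⊆ (⊂-wellFounded (C ─ J)) (C , C∈𝒞 , refl) =
      begin
        1ℚ              ≤⟨ covers/J D D∈𝒞/J ⟩
        sumOn D y       ≤⟨ sumOn-mono-⊆ D (C ─ J) y 0≤y D⊆C─J ⟩
        sumOn (C ─ J) y ≡⟨ sumOn-─ C J y y≡0-on-J ⟩
        sumOn C y       ∎
      where open ℚ.≤-Reasoning

  extreme-contract⇒extreme : ∀ {x} → IsExtremePoint (∁ J) (Contract (members 𝒞) J) x →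
                             IsExtremePoint ⊤ (members 𝒞) x
  extreme-contract⇒extreme {x} (x∈P/J , extreme) = x∈P , segment
    where
    x∈P : InPolyhedron ⊤ (members 𝒞) x
    x∈P = proj₁ (inPolyhedron-contract⁻ x∈P/J)
    x≡0-on-J : ∀ v → v ∈ J → x v ≡ 0ℚ
    x≡0-on-J = proj₂ (inPolyhedron-contract⁻ x∈P/J)
    segment : ∀ t y z → 0ℚ < t → t < 1ℚ → InPolyhedron ⊤ (members 𝒞) y →
              InPolyhedron ⊤ (members 𝒞) z → (∀ v → x v ≡ t * y v + (1ℚ - t) * z v) → y ≡ z
    segment t y z 0<t t<1 y∈P z∈P x≡ty+[1-t]z = extreme t y z 0<t t<1
      (inPolyhedron-contract⁺ y∈P (λ v → proj₁ ∘ y,z≡0-on-J v))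
      (inPolyhedron-contract⁺ z∈P (λ v → proj₂ ∘ y,z≡0-on-J v)) x≡ty+[1-t]z
      where
      y,z≡0-on-J : ∀ v → v ∈ J → y v ≡ 0ℚ × z v ≡ 0ℚ
      y,z≡0-on-J v v∈J =
        convex-combination≡0 0<t t<1 (inPolyhedron-nonNeg y∈P v) (inPolyhedron-nonNeg z∈P v)
                             (trans (sym (x≡ty+[1-t]z v)) (x≡0-on-J v v∈J))

  extreme⇒extreme-contract : ∀ {x} → IsExtremePoint ⊤ (members 𝒞) x → (∀ v → v ∈ J → x v ≡ 0ℚ) →
                             IsExtremePoint (∁ J) (Contract (members 𝒞) J) x
  extreme⇒extreme-contract (x∈P , extreme) x≡0-on-J =
    inPolyhedron-contract⁺ x∈P x≡0-on-J , λ t y z 0<t t<1 y∈P/J z∈P/J →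
      extreme t y z 0<t t<1 (proj₁ (inPolyhedron-contract⁻ y∈P/J)) (proj₁ (inPolyhedron-contract⁻ z∈P/J))

  contract-ideal : Ideal ⊤ (members 𝒞) → Ideal (∁ J) (Contract (members 𝒞) J)
  contract-ideal ideal x = ideal x ∘ extreme-contract⇒extreme

zero-in-part? : ∀ {m n} (part : Fin m → Fin n) (x : Fin m → ℚ) i → Dec (∃ λ v → part v ≡ i × x v ≡ 0ℚ)
zero-in-part? part x i = any? (λ v → part v ≟ i ×-dec x v ℚ.≟ 0ℚ)

zero-transversal⊎positive-part : ∀ {m n} (part : Fin m → Fin n) (x : Fin m → ℚ) → (∀ v → 0ℚ ≤ x v) →
                                 (∃ λ (c : Fin n → Fin m) → ∀ i → part (c i) ≡ i × x (c i) ≡ 0ℚ) ⊎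
                                 (∃ λ i → ∀ v → part v ≡ i → 0ℚ < x v)
zero-transversal⊎positive-part part x 0≤x with all? (zero-in-part? part x)
... | yes zero-in-every-part = inj₁ (proj₁ ∘ zero-in-every-part , proj₂ ∘ zero-in-every-part)
... | no ¬zero-in-every-part
  with i , no-zero ← ¬∀⟶∃¬ _ _ (zero-in-part? part x) ¬zero-in-every-part =
  inj₂ (i , λ v part-v≡i → 0≤p∧p≢0⇒0<p (0≤x v) (λ x-v≡0 → no-zero (v , part-v≡i , x-v≡0)))

transversalSet : ∀ {m n} → (Fin m → Fin n) → (Fin n → Fin m) → Subset m
transversalSet part c = tabulate (λ v → does (c (part v) ≟ v))

transversalSet-transversal : ∀ {m n} (part : Fin m → Fin n) c → Transversal part c (transversalSet part c)
transversalSet-transversal part c v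
  with c (part v) ≟ v | lookup∘tabulate (λ w → does (c (part w) ≟ w)) v
... | yes c[part-v]≡v | v∈J = (λ _ → c[part-v]≡v) , λ _ → lookup⇒[]= v _ v∈J
... | no c[part-v]≢v | v∉J =
  (λ v∈J → contradiction (trans (sym ([]=⇒lookup v∈J)) v∉J) λ ()) , ⊥-elim ∘ c[part-v]≢v

indicator : ∀ {A : Set} → Dec A → ℚ
indicator (yes _) = 1ℚ
indicator (no _) = 0ℚ

indicator-yes : ∀ {A : Set} (a? : Dec A) → A → indicator a? ≡ 1ℚ
indicator-yes (yes _) _ = refl
indicator-yes (no ¬a) a = ⊥-elim (¬a a)

indicator-no : ∀ {A : Set} (a? : Dec A) → ¬ A → indicator a? ≡ 0ℚ
indicator-no (yes a) ¬a = ⊥-elim (¬a a)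
indicator-no (no _) _ = refl

indicator-integral : ∀ {A : Set} (a? : Dec A) → ∃ λ k → indicator a? ≡ k / 1
indicator-integral (yes _) = ℤ.+ 1 , refl
indicator-integral (no _) = ℤ.+ 0 , refl

LocalizationsIdeal : ∀ {m n} → (Fin m → Fin n) → List (Subset m) → Set
LocalizationsIdeal part 𝒞 =
  ∀ c J → (∀ i → part (c i) ≡ i) → Transversal part c J → Ideal (∁ J) (Contract (members 𝒞) J)

module _ {m n} (part : Fin m → Fin n) {𝒞 : List (Subset m)} (uniform : MultipartiteUniform part 𝒞) where

  sumOn-part-indicator : ∀ i C → C ∈ₗ 𝒞 → sumOn C (λ v → indicator (part v ≟ i)) ≡ 1ℚ
  sumOn-part-indicator i C C∈𝒞 with v , v∈C , part-v≡i , unique ← uniform C∈𝒞 i =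
    trans (sumOn-unique C _ v∈C (λ w w∈C w≢v → indicator-no (part w ≟ i) (w≢v ∘ unique w w∈C)))
          (indicator-yes (part v ≟ i) part-v≡i)

  extreme-bounded-below-on-part : ∀ {x} → IsExtremePoint ⊤ (members 𝒞) x → ∀ i {δ} → 0ℚ < δ → δ ≤ 1ℚ →
                            (∀ v → part v ≡ i → δ ≤ x v) → ∀ v → x v ≡ indicator (part v ≟ i)
  extreme-bounded-below-on-part {x} x-extreme@(x∈P , _) i {δ} 0<δ δ≤1 δ≤x v =
    x∙y⁻¹≈ε⇒x≈y (x v) (e v) (x-e≡0 v)
    where
    e : Fin m → ℚ
    e w = indicator (part w ≟ i)
    e-cases : ∀ w → e w ≡ 0ℚ ⊎ (e w ≡ 1ℚ × δ ≤ x w)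
    e-cases w with part w ≟ i
    ... | yes part-w≡i = inj₂ (refl , δ≤x w part-w≡i)
    ... | no _ = inj₁ refl
    x±δ[x-e]-nonNeg : ∀ w → 0ℚ ≤ x w + δ * (x w - e w) × 0ℚ ≤ x w + (- δ) * (x w - e w)
    x±δ[x-e]-nonNeg w = p±δ[p-e]-nonNeg (inPolyhedron-nonNeg x∈P w) (ℚ.<⇒≤ 0<δ) δ≤1 (e-cases w)
    x-e≡0 : ∀ w → x w - e w ≡ 0ℚ
    x-e≡0 = extreme-direction≡0 x-extreme δ (λ w → x w - e w) 0<δ
      (perturbation-inPolyhedron (sumOn-part-indicator i) x∈P δ (0≤p+q (ℚ.<⇒≤ 0<1) (ℚ.<⇒≤ 0<δ))
                                 (proj₁ ∘ x±δ[x-e]-nonNeg))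
      (perturbation-inPolyhedron (sumOn-part-indicator i) x∈P (- δ) (p≤q⇒0≤q-p δ≤1)
                                 (proj₂ ∘ x±δ[x-e]-nonNeg))

  localizations-ideal⇒ideal : LocalizationsIdeal part 𝒞 → Ideal ⊤ (members 𝒞)
  localizations-ideal⇒ideal localizations-ideal x x-extreme@(x∈P , _)
    with zero-transversal⊎positive-part part x (inPolyhedron-nonNeg x∈P)
  ... | inj₂ (i , 0<x) with δ , 0<δ , δ≤1 , δ≤x ← positive-lower-bound (λ v → part v ≟ i) x 0<x = λ v →
    subst (λ q → ∃ λ k → q ≡ k / 1) (sym (extreme-bounded-below-on-part x-extreme i 0<δ δ≤1 δ≤x v))
          (indicator-integral (part v ≟ i))
  ... | inj₁ (c , c-transversal) =
    localizations-ideal c J (proj₁ ∘ c-transversal) J-transversal x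
                        (extreme⇒extreme-contract 𝒞 J x-extreme x≡0-on-J)
    where
    J : Subset m
    J = transversalSet part c
    J-transversal : Transversal part c J
    J-transversal = transversalSet-transversal part c
    x≡0-on-J : ∀ v → v ∈ J → x v ≡ 0ℚ
    x≡0-on-J v v∈J = subst (λ w → x w ≡ 0ℚ) (proj₁ (J-transversal v) v∈J) (proj₂ (c-transversal (part v)))

theorem2p7 : ∀ {m n : ℕ} (part : Fin m → Fin n) →
    (∀ i → ∃ λ v → part v ≡ i) →
    (𝒞 : List (Subset m)) → IsClutter 𝒞 → MultipartiteUniform part 𝒞 →
    (Ideal ⊤ (members 𝒞) →
      ∀ (c : Fin n → Fin m) (J : Subset m) → (∀ i → part (c i) ≡ i) →
        Transversal part c J → Ideal (∁ J) (Contract (members 𝒞) J))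
    × ((∀ (c : Fin n → Fin m) (J : Subset m) → (∀ i → part (c i) ≡ i) →
        Transversal part c J → Ideal (∁ J) (Contract (members 𝒞) J)) →
      Ideal ⊤ (members 𝒞))
theorem2p7 part _ 𝒞 _ uniform =
  (λ ideal c J _ _ → contract-ideal 𝒞 J ideal) , localizations-ideal⇒ideal part uniform
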